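{- Let $\mathbf{H}$ be the minimal normal hybrid logic in the language with nominals (propositional tautologies, the dual axiom $\Diamond p \leftrightarrow \neg\Box\neg p$, axiom $K$, and the axioms $\Diamond^n(\mathbf{i}\wedge p)\to\Box^m(\mathbf{i}\to p)$ for all $n,m\in\mathbb{N}$, closed under modus ponens, sorted substitution, necessitation and the rule "if $\vdash\neg\mathbf{i}$ then $\vdash\bot$"), and let $\mathbf{H}^{+}$ be obtained by additionally closing under the rules (Name): if $\vdash \mathbf{i}\to\phi$ then $\vdash\phi$ for $\mathbf{i}$ not occurring in $\phi$, and (Paste): if $\vdash \Diamond^{n}(\mathbf{i} \wedge \Diamond(\mathbf{j} \wedge \phi)) \to \psi$ then $\vdash \Diamond^{n}(\mathbf{i} \wedge \Diamond\phi) \to \psi$ for $\mathbf{i}\neq\mathbf{j}$ and $\mathbf{j}$ not occurring in $\phi,\psi$. Let $\Sigma=\{\mathbf{j}\to\Box\bot\}$. Then $\mathbf{H}\oplus\Sigma \not\vdash \Box\bot$, while $\mathbf{H}^{+}\oplus\Sigma \vdash \Box\bot$.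
   Context: A two-sorted general frame is $\mathfrak{g}=(W,R,A,B)$ with $(W,R,A)$ a general frame and $B\subseteq W$ non-empty with $\{w\}\in A$ for all $w\in B$; admissible valuations send nominals to singletons $\{w\}$ with $w\in B$. The witness is the descriptive two-sorted general frame $\mathfrak{g}=(W,R,A,B)$ with $W=\{u,v\}$, $R=\{(u,u)\}$, $A=\mathcal{P}(W)$, $B=\{v\}$: it validates $\mathbf{j}\to\Box\bot$ and satisfies $\Diamond\top$ at $u$; the non-derivability follows from soundness of $\mathbf{H}\oplus\Sigma$ with respect to its descriptive two-sorted general frames, and the derivability follows by applying (Name) to $\mathbf{j}\to\Box\bot$. -}

module Defs where

open import Data.Nat using (ℕ; zero; suc)
open import Data.Bool using (Bool; true; false; _∧_; not; _∨_)
open import Data.Empty using (⊥)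
open import Data.Unit using (⊤)
open import Data.Product using (_×_)
open import Data.Sum using (_⊎_)
open import Relation.Binary.PropositionalEquality using (_≡_)
open import Relation.Nullary using (¬_)

-- Syntax of the basic hybrid language: propositional variables and
-- nominals (both indexed by ℕ), ⊥, →, □ and ◇ (◇ primitive, related to
-- □ by the dual axiom).

infixr 5 _⇒_

data Form : Set where
  var : ℕ → Form
  nom : ℕ → Form
  ⊥'  : Form
  _⇒_ : Form → Form → Form
  □   : Form → Form
  ◇   : Form → Form

¬' : Form → Form
¬' φ = φ ⇒ ⊥'

⊤' : Form
⊤' = ¬' ⊥'

_∧'_ : Form → Form → Form
φ ∧' ψ = ¬' (φ ⇒ ¬' ψ)

_⇔_ : Form → Form → Form
φ ⇔ ψ = (φ ⇒ ψ) ∧' (ψ ⇒ φ)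

◇^ : ℕ → Form → Form
◇^ zero    φ = φ
◇^ (suc n) φ = ◇ (◇^ n φ)

□^ : ℕ → Form → Form
□^ zero    φ = φ
□^ (suc n) φ = □ (□^ n φ)

-- Propositional tautologies: formulas true under every Boolean
-- valuation, where every formula that is not ⊥ or an implication is
-- treated as a propositional atom (i.e. substitution instances of
-- classical propositional tautologies).

evalB : (Form → Bool) → Form → Bool
evalB v ⊥'      = false
evalB v (φ ⇒ ψ) = not (evalB v φ) ∨ evalB v ψ
evalB v φ       = v φ

Tautology : Form → Set
Tautology φ = (v : Form → Bool) → evalB v φ ≡ true

record Subst : Set where
  field
    pv : ℕ → Form
    nv : ℕ → ℕ
open Subst public

_[_] : Form → Subst → Form
var p   [ σ ] = pv σ p
nom i   [ σ ] = nom (nv σ i)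
⊥'      [ σ ] = ⊥'
(φ ⇒ ψ) [ σ ] = (φ [ σ ]) ⇒ (ψ [ σ ])
□ φ     [ σ ] = □ (φ [ σ ])
◇ φ     [ σ ] = ◇ (φ [ σ ])

Occurs : ℕ → Form → Set
Occurs i (var p)   = ⊥
Occurs i (nom k)   = i ≡ k
Occurs i ⊥'        = ⊥
Occurs i (φ ⇒ ψ)   = Occurs i φ ⊎ Occurs i ψ
Occurs i (□ φ)     = Occurs i φ
Occurs i (◇ φ)     = Occurs i φ

-- Axioms of H (with fixed letters p = var 0, q = var 1, i = nom 0;
-- sorted substitution yields all instances).

p₀ q₀ : Form
p₀ = var 0
q₀ = var 1

i₀ : ℕ
i₀ = 0

data AxiomH : Form → Set where
  ax-dual : AxiomH (◇ p₀ ⇔ ¬' (□ (¬' p₀)))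
  ax-K    : AxiomH (□ (p₀ ⇒ q₀) ⇒ (□ p₀ ⇒ □ q₀))
  ax-nom  : (n m : ℕ) →
            AxiomH (◇^ n (nom i₀ ∧' p₀) ⇒ □^ m (nom i₀ ⇒ p₀))

data Calculus : Set where
  H H⁺ : Calculus

data _⊕_⊢_ (L : Calculus) (Σ : Form → Set) : Form → Set where
  taut  : ∀ {φ} → Tautology φ → L ⊕ Σ ⊢ φ
  axH   : ∀ {φ} → AxiomH φ → L ⊕ Σ ⊢ φ
  extra : ∀ {φ} → Σ φ → L ⊕ Σ ⊢ φ
  mp    : ∀ {φ ψ} → L ⊕ Σ ⊢ (φ ⇒ ψ) → L ⊕ Σ ⊢ φ → L ⊕ Σ ⊢ ψ
  subst : ∀ {φ} (σ : Subst) → L ⊕ Σ ⊢ φ → L ⊕ Σ ⊢ (φ [ σ ])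
  nec   : ∀ {φ} → L ⊕ Σ ⊢ φ → L ⊕ Σ ⊢ □ φ
  notNom : ∀ {i} → L ⊕ Σ ⊢ ¬' (nom i) → L ⊕ Σ ⊢ ⊥'
  name  : ∀ {i φ} → L ≡ H⁺ → ¬ Occurs i φ →
          L ⊕ Σ ⊢ (nom i ⇒ φ) → L ⊕ Σ ⊢ φ
  paste : ∀ {n i j φ ψ} → L ≡ H⁺ → ¬ (i ≡ j) →
          ¬ Occurs j φ → ¬ Occurs j ψ →
          L ⊕ Σ ⊢ (◇^ n (nom i ∧' ◇ (nom j ∧' φ)) ⇒ ψ) →
          L ⊕ Σ ⊢ (◇^ n (nom i ∧' ◇ φ) ⇒ ψ)

j₀ : ℕ
j₀ = 0

Σ₀ : Form → Set
Σ₀ φ = φ ≡ (nom j₀ ⇒ □ ⊥')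

module Submission where

open import Defs
open import Data.Product using (_×_; _,_)
open import Relation.Nullary using (¬_)
open import Data.Nat using (ℕ; zero; suc)
open import Data.Bool using (Bool; true; false; not; _∨_)
open import Data.Bool.Properties using (∨-zeroʳ)
open import Relation.Binary.PropositionalEquality using (_≡_; refl; sym; trans)

-- H ⊕ Σ is sound for the two-world model W = {u, v}, R = {(u, u)}, in which
-- every nominal names the dead end v. Since v has no successor, j → □⊥
-- holds everywhere, while □⊥ fails at the reflexive world u; so H ⊕ Σ does
-- not prove □⊥. In H⁺, (Name) applied to the axiom j → □⊥ yields □⊥.

data World : Set where
  u v : World

Valuation : Set
Valuation = ℕ → World → Bool

⟦_⟧ : Form → Valuation → World → Bool
⟦ var p ⟧ V w   = V p w
⟦ nom i ⟧ V u   = false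
⟦ nom i ⟧ V v   = true
⟦ ⊥' ⟧ V w      = false
⟦ φ ⇒ ψ ⟧ V w   = not (⟦ φ ⟧ V w) ∨ ⟦ ψ ⟧ V w
⟦ □ φ ⟧ V u     = ⟦ φ ⟧ V u
⟦ □ φ ⟧ V v     = true
⟦ ◇ φ ⟧ V u     = ⟦ φ ⟧ V u
⟦ ◇ φ ⟧ V v     = false

Valid : Form → Set
Valid φ = ∀ V w → ⟦ φ ⟧ V w ≡ true

evalB-⟦⟧ : ∀ V w φ → evalB (λ ψ → ⟦ ψ ⟧ V w) φ ≡ ⟦ φ ⟧ V w
evalB-⟦⟧ V w (var p)  = refl
evalB-⟦⟧ V w (nom i)  = refl
evalB-⟦⟧ V w ⊥'       = refl
evalB-⟦⟧ V w (φ ⇒ ψ) rewrite evalB-⟦⟧ V w φ | evalB-⟦⟧ V w ψ = refl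
evalB-⟦⟧ V w (□ φ)    = refl
evalB-⟦⟧ V w (◇ φ)    = refl

Tautology⇒Valid : ∀ {φ} → Tautology φ → Valid φ
Tautology⇒Valid {φ} t V w = trans (sym (evalB-⟦⟧ V w φ)) (t (λ ψ → ⟦ ψ ⟧ V w))

-- Renaming nominals is invisible: they all denote the same world.
⟦[]⟧ : ∀ σ V w φ → ⟦ φ [ σ ] ⟧ V w ≡ ⟦ φ ⟧ (λ p → ⟦ pv σ p ⟧ V) w
⟦[]⟧ σ V w (var p)  = refl
⟦[]⟧ σ V u (nom i)  = refl
⟦[]⟧ σ V v (nom i)  = refl
⟦[]⟧ σ V w ⊥'       = refl
⟦[]⟧ σ V w (φ ⇒ ψ) rewrite ⟦[]⟧ σ V w φ | ⟦[]⟧ σ V w ψ = refl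
⟦[]⟧ σ V u (□ φ)    = ⟦[]⟧ σ V u φ
⟦[]⟧ σ V v (□ φ)    = refl
⟦[]⟧ σ V u (◇ φ)    = ⟦[]⟧ σ V u φ
⟦[]⟧ σ V v (◇ φ)    = refl

⟦◇^⟧-u : ∀ n φ V → ⟦ ◇^ n φ ⟧ V u ≡ ⟦ φ ⟧ V u
⟦◇^⟧-u zero    φ V = refl
⟦◇^⟧-u (suc n) φ V = ⟦◇^⟧-u n φ V

AxiomH⇒Valid : ∀ {φ} → AxiomH φ → Valid φ
AxiomH⇒Valid ax-dual V u with V 0 u
... | true  = refl
... | false = refl
AxiomH⇒Valid ax-dual V v = refl
AxiomH⇒Valid ax-K V u with V 0 u | V 1 u
... | true  | true  = refl
... | true  | false = refl
... | false | _     = refl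
AxiomH⇒Valid ax-K V v = refl
AxiomH⇒Valid (ax-nom n m) V u rewrite ⟦◇^⟧-u n (nom i₀ ∧' p₀) V = refl
AxiomH⇒Valid (ax-nom zero zero) V v with V 0 v
... | true  = refl
... | false = refl
AxiomH⇒Valid (ax-nom zero (suc m)) V v = ∨-zeroʳ _
AxiomH⇒Valid (ax-nom (suc n) m) V v = refl

⇒-elimᵇ : ∀ {a b} → not a ∨ b ≡ true → a ≡ true → b ≡ true
⇒-elimᵇ a⇒b refl = a⇒b

sound : ∀ {Σ φ} → (∀ {ψ} → Σ ψ → Valid ψ) → H ⊕ Σ ⊢ φ → Valid φ
sound valid-Σ (taut {φ} t)       = Tautology⇒Valid {φ} t
sound valid-Σ (axH a)            = AxiomH⇒Valid a
sound valid-Σ (extra s)          = valid-Σ s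
sound valid-Σ (mp d e) V w       = ⇒-elimᵇ (sound valid-Σ d V w) (sound valid-Σ e V w)
sound valid-Σ (subst {φ} σ d) V w =
  trans (⟦[]⟧ σ V w φ) (sound valid-Σ d (λ p → ⟦ pv σ p ⟧ V) w)
sound valid-Σ (nec d) V u        = sound valid-Σ d V u
sound valid-Σ (nec d) V v        = refl
sound valid-Σ (notNom d) V w with sound valid-Σ d V v
... | ()
sound valid-Σ (name () _ _)
sound valid-Σ (paste () _ _ _ _)

Σ₀-valid : ∀ {ψ} → Σ₀ ψ → Valid ψ
Σ₀-valid refl V u = refl
Σ₀-valid refl V v = refl

□⊥-invalid : ¬ Valid (□ ⊥')
□⊥-invalid valid with valid (λ _ _ → false) u
... | ()

mainTheorem1 : (¬ (H ⊕ Σ₀ ⊢ □ ⊥')) × (H⁺ ⊕ Σ₀ ⊢ □ ⊥')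
mainTheorem1 =
    (λ d → □⊥-invalid (sound Σ₀-valid d))
  , name {i = j₀} refl (λ ()) (extra refl)
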